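{- Let $p$ be a prime and let $\alpha$ be a positive integer not divisible by $p$. Then the limit $\lim_{e\to\infty}(-1)^{p\alpha e}\,\mathrm{u}\big((\alpha p^e)!\big)$ exists in the ring $\mathbb{Z}_p$ of $p$-adic integers (with respect to the $p$-adic metric).
   Context: For a prime $p$ and a positive integer $n$, $\nu(n)=\nu_p(n)$ denotes the exponent of $p$ in $n$, and $\mathrm{u}(n)=n/p^{\nu(n)}$ denotes the unit part of $n$ with respect to $p$. The $p$-adic metric on $\mathbb{Z}_p$ is $d(x,y)=p^{ -\nu(x-y)}$. -}

module Defs where

open import Data.Nat using (ℕ; zero; suc; _≤_; _^_)
open import Data.Nat.Divisibility using (_∣?_; divides)
open import Data.Integer using (ℤ; +_; _-_)
open import Data.Integer.Divisibility using (_∣_)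
open import Data.Product using (∃)
open import Relation.Nullary using (yes; no)

-- Unit part with respect to p, computed by repeatedly dividing out p.
-- The fuel argument bounds the number of divisions; fuel n suffices for
-- n > 0 and p ≥ 2 (each division at least halves n).
unitPartAux : ℕ → ℕ → ℕ → ℕ
unitPartAux p zero    n       = n
unitPartAux p (suc f) zero    = zero
unitPartAux p (suc f) (suc m) with p ∣? suc m
... | yes (divides q _) = unitPartAux p f q
... | no  _             = suc m

-- u(n) = n / p^ν(n)   (meaningful for n > 0, p prime)
unitPart : ℕ → ℕ → ℕ
unitPart p n = unitPartAux p n n

-- The ring of p-adic integers as the inverse limit lim ℤ/p^k:
-- a sequence of integer representatives x_k of residues mod p^k,
-- compatible: x_{k+1} ≡ x_k (mod p^k).
record ℤ[_] (p : ℕ) : Set where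
  field
    seq : ℕ → ℤ
    coh : ∀ k → + (p ^ k) ∣ (seq (suc k) - seq k)

open ℤ[_] public

-- An integer sequence a converges to x in ℤ_p for the p-adic metric:
-- for every k there is N with d(a_e, x) ≤ p^{-k}, i.e. a_e ≡ x (mod p^k),
-- for all e ≥ N.
ConvergesTo : (p : ℕ) → (ℕ → ℤ) → ℤ[ p ] → Set
ConvergesTo p a x = ∀ k → ∃ λ N → ∀ e → N ≤ e → + (p ^ k) ∣ (a e - seq x k)

HasLimit : (p : ℕ) → (ℕ → ℤ) → Set
HasLimit p a = ∃ λ (x : ℤ[ p ]) → ConvergesTo p a x

{-# OPTIONS --safe #-}
-- The multiples of p in [1, mp] are p, 2p, …, mp, so (mp)! = G(m)·pᵐ·m! where G(m) is
-- the product of the integers in [1, mp] prime to p; hence u((mp)!) = G(m)·u(m!), and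
-- consecutive terms of the sequence differ by the factor ±G(αpᵉ). By Wilson's theorem
-- each block of p - 1 consecutive units contributes -1 mod p, so G(P) ≡ (-1)^P mod p,
-- and G(cP) ≡ G(P)^c mod pP because the blocks are periodic mod pP. Raising a
-- congruence mod p to the power pⁿ lifts it to a congruence mod pⁿ⁺¹. Taking P = pᵏ
-- and e = k + n with k ≤ n gives G(αpᵉ) ≡ (-1)^(αpᵉ) mod pᵏ⁺¹, which the sign
-- (-1)^(pαe) compensates exactly: consecutive terms agree mod pᵏ once e ≥ 2k, so the
-- sequence is Cauchy in ℤ_p.
module Submission where

open import Defs

open import Data.Nat as ℕ
  using (ℕ; zero; suc; pred; z≤n; s≤s; _≤_; _<_; _∸_; _!; NonZero; NonTrivial)
  renaming (_+_ to _+ℕ_; _*_ to _*ℕ_; _^_ to _^ℕ_)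
import Data.Nat.Properties as ℕ
import Data.Nat.Divisibility as ℕ
open import Data.Nat.Coprimality using (coprime-Bézout; prime⇒coprime)
open import Data.Nat.GCD using (module Bézout)
open import Data.Nat.ListAction using (product)
open import Data.Nat.ListAction.Properties using (product-↭)
open import Data.Nat.Primality using (Prime; euclidsLemma; ¬prime[1])
open import Data.Nat.Tactic.RingSolver using () renaming (solve-∀ to ℕ-solve-∀)
open import Data.Integer using (ℤ; +_; -_; _+_; _-_; _*_; _^_; 0ℤ; 1ℤ; -1ℤ) renaming (∣_∣ to abs)
import Data.Integer.Properties as ℤ
import Data.Integer.DivMod as ℤ
open import Data.Integer.DivMod using (_%ℕ_; _/ℕ_)
open import Data.Integer.Divisibility.Signed
  using ( _∣_; divides; ∣-refl; ∣-trans; ∣m∣n⇒∣m+n; ∣m⇒∣-m; ∣n⇒∣m*n; ∣m⇒∣m*n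
        ; *-monoʳ-∣; *-monoˡ-∣; ∣ᵤ⇒∣; ∣⇒∣ᵤ)
open import Data.Integer.Tactic.RingSolver using (solve-∀)
open import Data.List using (List; []; _∷_; _++_; [_]; length; applyDownFrom)
open import Data.List.Membership.Propositional using (_∈_; _∉_)
open import Data.List.Membership.Propositional.Properties using (∈-∃++; ∈-applyDownFrom⁺; ∈-applyDownFrom⁻)
open import Data.List.Relation.Unary.Any using (here; there)
open import Data.List.Relation.Unary.Unique.Propositional as Unique using (Unique)
open import Data.List.Relation.Unary.Unique.Propositional.Properties using (Unique[x∷xs]⇒x∉xs; applyDownFrom⁺₁)
open import Data.List.Relation.Binary.Permutation.Propositional using (_↭_; ↭-sym; ↭⇒↭ₛ)
open import Data.List.Relation.Binary.Permutation.Propositional.Properties using (shift; ∈-resp-↭; ↭-length)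
open import Data.Product using (∃-syntax; _×_; _,_; proj₁; proj₂)
open import Data.Sum as Sum using (_⊎_; inj₁; inj₂; [_,_]′)
open import Function using (_∘_)
open import Relation.Binary.Bundles using (Setoid)
open import Relation.Binary.Structures using (IsEquivalence)
import Relation.Binary.Reasoning.Setoid as SetoidReasoning
open import Relation.Binary.PropositionalEquality
  using (_≡_; _≢_; refl; sym; trans; cong; cong₂; subst; subst₂; setoid; module ≡-Reasoning)
open import Data.List.Relation.Binary.Permutation.Setoid.Properties (setoid ℕ) using (Unique-resp-↭)
open import Relation.Nullary using (¬_; yes; no; contradiction)

infix 4 _≡_mod_

record _≡_mod_ (x y : ℤ) (n : ℕ) : Set where
  constructor ≡mod
  field n∣x-y : + n ∣ x - y

open _≡_mod_ public

module _ {n : ℕ} where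

  ≡⇒≡mod : ∀ {x y} → x ≡ y → x ≡ y mod n
  ≡⇒≡mod {x} refl = ≡mod (divides 0ℤ (ℤ.+-inverseʳ x))

  ≡mod-refl : ∀ {x} → x ≡ x mod n
  ≡mod-refl = ≡⇒≡mod refl

  ≡mod-sym : ∀ {x y} → x ≡ y mod n → y ≡ x mod n
  ≡mod-sym {x} {y} (≡mod n∣x-y) = ≡mod (subst (+ n ∣_) (negate x y) (∣m⇒∣-m n∣x-y))
    where
    negate : ∀ x y → - (x - y) ≡ y - x
    negate = solve-∀

  ≡mod-trans : ∀ {x y z} → x ≡ y mod n → y ≡ z mod n → x ≡ z mod n
  ≡mod-trans {x} {y} {z} (≡mod n∣x-y) (≡mod n∣y-z) =
    ≡mod (subst (+ n ∣_) (telescope x y z) (∣m∣n⇒∣m+n n∣x-y n∣y-z))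
    where
    telescope : ∀ x y z → (x - y) + (y - z) ≡ x - z
    telescope = solve-∀

  ≡mod-isEquivalence : IsEquivalence (λ x y → x ≡ y mod n)
  ≡mod-isEquivalence = record { refl = ≡mod-refl ; sym = ≡mod-sym ; trans = ≡mod-trans }

  +-cong-mod : ∀ {x x′ y y′} → x ≡ x′ mod n → y ≡ y′ mod n → x + y ≡ x′ + y′ mod n
  +-cong-mod {x} {x′} {y} {y′} (≡mod n∣x-x′) (≡mod n∣y-y′) =
    ≡mod (subst (+ n ∣_) (regroup x x′ y y′) (∣m∣n⇒∣m+n n∣x-x′ n∣y-y′))
    where
    regroup : ∀ x x′ y y′ → (x - x′) + (y - y′) ≡ (x + y) - (x′ + y′)
    regroup = solve-∀

  *-cong-mod : ∀ {x x′ y y′} → x ≡ x′ mod n → y ≡ y′ mod n → x * y ≡ x′ * y′ mod n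
  *-cong-mod {x} {x′} {y} {y′} (≡mod n∣x-x′) (≡mod n∣y-y′) =
    ≡mod (subst (+ n ∣_) (regroup x x′ y y′) (∣m∣n⇒∣m+n (∣n⇒∣m*n x n∣y-y′) (∣m⇒∣m*n y′ n∣x-x′)))
    where
    regroup : ∀ x x′ y y′ → x * (y - y′) + (x - x′) * y′ ≡ x * y - x′ * y′
    regroup = solve-∀

  ^-cong-mod : ∀ {x y} k → x ≡ y mod n → x ^ k ≡ y ^ k mod n
  ^-cong-mod zero    x≡y = ≡mod-refl
  ^-cong-mod (suc k) x≡y = *-cong-mod x≡y (^-cong-mod k x≡y)

≡mod-setoid : ℕ → Setoid _ _
≡mod-setoid n = record { isEquivalence = ≡mod-isEquivalence {n} }

module ≡mod-Reasoning (n : ℕ) = SetoidReasoning (≡mod-setoid n)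

≡mod-∣ : ∀ {m n x y} → m ℕ.∣ n → x ≡ y mod n → x ≡ y mod m
≡mod-∣ m∣n (≡mod n∣x-y) = ≡mod (∣-trans (∣ᵤ⇒∣ m∣n) n∣x-y)

∣∧<⇒≡0 : ∀ {n k} → n ℕ.∣ k → k < n → k ≡ 0
∣∧<⇒≡0 {k = zero}  _   _   = refl
∣∧<⇒≡0 {k = suc _} n∣k k<n = contradiction n∣k (ℕ.>⇒∤ k<n)

+-injective-mod : ∀ {n x y} → x < n → y < n → + x ≡ + y mod n → x ≡ y
+-injective-mod {n} x<n y<n x≡y =
  [ ordered y<n x≡y , (λ y≤x → sym (ordered x<n (≡mod-sym x≡y) y≤x)) ]′ (ℕ.≤-total _ _)
  where
  ordered : ∀ {x y} → y < n → + x ≡ + y mod n → x ≤ y → x ≡ y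
  ordered {x} y<n (≡mod n∣x-y) x≤y with k , refl ← ℕ.m≤n⇒∃[o]m+o≡n x≤y =
    trans (sym (ℕ.+-identityʳ x)) (cong (x +ℕ_) (sym k≡0))
    where
    cancel : ∀ x k → - (x - (x + k)) ≡ k
    cancel = solve-∀
    n∣k : + n ∣ + k
    n∣k = subst (+ n ∣_) (trans (cong (λ z → - (+ x - z)) (ℤ.pos-+ x k)) (cancel (+ x) (+ k))) (∣m⇒∣-m n∣x-y)
    k≡0 : k ≡ 0
    k≡0 = ∣∧<⇒≡0 (∣⇒∣ᵤ n∣k) (ℕ.≤-<-trans (ℕ.m≤n+m k x) y<n)

≡mod-%ℕ : ∀ n .{{_ : NonZero n}} z → z ≡ + (z %ℕ n) mod n
≡mod-%ℕ n z = ≡mod (divides (z /ℕ n) (begin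
  z - r                 ≡⟨ cong (_- r) (ℤ.a≡a%ℕn+[a/ℕn]*n z n) ⟩
  r + z /ℕ n * + n - r  ≡⟨ cancel r (z /ℕ n) (+ n) ⟩
  z /ℕ n * + n          ∎))
  where
  open ≡-Reasoning
  r : ℤ
  r = + (z %ℕ n)
  cancel : ∀ r q n → r + q * n - r ≡ q * n
  cancel = solve-∀

+[t*n+a]≡+a : ∀ n t a → + (t *ℕ n +ℕ a) ≡ + a mod n
+[t*n+a]≡+a n t a = ≡mod (divides (+ t) (begin
  + (t *ℕ n +ℕ a) - + a    ≡⟨ cong (_- + a) (ℤ.pos-+ (t *ℕ n) a) ⟩
  + (t *ℕ n) + + a - + a   ≡⟨ cancel (+ (t *ℕ n)) (+ a) ⟩
  + (t *ℕ n)               ≡⟨ ℤ.pos-* t n ⟩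
  + t * + n                ∎))
  where
  open ≡-Reasoning
  cancel : ∀ x y → x + y - y ≡ x
  cancel = solve-∀

+n≡-1 : ∀ n → + n ≡ -1ℤ mod suc n
+n≡-1 n = ≡mod (divides 1ℤ (trans (regroup (+ n)) (cong (1ℤ *_) (sym (ℤ.pos-+ 1 n)))))
  where
  regroup : ∀ x → x - -1ℤ ≡ 1ℤ * (1ℤ + x)
  regroup = solve-∀

inverse-mod-unique : ∀ {n x y z} → x * z ≡ 1ℤ mod n → y * z ≡ 1ℤ mod n → x ≡ y mod n
inverse-mod-unique {n} {x} {y} {z} xz≡1 yz≡1 = begin
  x             ≡⟨ ℤ.*-identityʳ x ⟨
  x * 1ℤ        ≈⟨ *-cong-mod (≡mod-refl {x = x}) yz≡1 ⟨
  x * (y * z)   ≡⟨ swap x y z ⟩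
  y * (x * z)   ≈⟨ *-cong-mod (≡mod-refl {x = y}) xz≡1 ⟩
  y * 1ℤ        ≡⟨ ℤ.*-identityʳ y ⟩
  y             ∎
  where
  open ≡mod-Reasoning n
  swap : ∀ x y z → x * (y * z) ≡ y * (x * z)
  swap = solve-∀

∏ : ℕ → (ℕ → ℕ) → ℕ
∏ zero    f = 1
∏ (suc n) f = ∏ n f *ℕ f n

∏-+ : ∀ m n f → ∏ (m +ℕ n) f ≡ ∏ m f *ℕ ∏ n (λ i → f (m +ℕ i))
∏-+ m zero    f = trans (cong (λ k → ∏ k f) (ℕ.+-identityʳ m)) (sym (ℕ.*-identityʳ _))
∏-+ m (suc n) f = begin
  ∏ (m +ℕ suc n) f                                ≡⟨ cong (λ k → ∏ k f) (ℕ.+-suc m n) ⟩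
  ∏ (m +ℕ n) f *ℕ f (m +ℕ n)                       ≡⟨ cong (_*ℕ f (m +ℕ n)) (∏-+ m n f) ⟩
  ∏ m f *ℕ ∏ n (λ i → f (m +ℕ i)) *ℕ f (m +ℕ n)    ≡⟨ ℕ.*-assoc (∏ m f) _ _ ⟩
  ∏ m f *ℕ ∏ (suc n) (λ i → f (m +ℕ i))            ∎
  where open ≡-Reasoning

module _ {d : ℕ} where

  ∏-cong-mod : ∀ n {f g} → (∀ i → i < n → + f i ≡ + g i mod d) → + ∏ n f ≡ + ∏ n g mod d
  ∏-cong-mod zero    f≡g = ≡mod-refl
  ∏-cong-mod (suc n) {f} {g} f≡g = begin
    + (∏ n f *ℕ f n)   ≡⟨ ℤ.pos-* (∏ n f) (f n) ⟩
    + ∏ n f * + f n    ≈⟨ *-cong-mod (∏-cong-mod n (λ i i<n → f≡g i (ℕ.m<n⇒m<1+n i<n))) (f≡g n ℕ.≤-refl) ⟩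
    + ∏ n g * + g n    ≡⟨ ℤ.pos-* (∏ n g) (g n) ⟨
    + (∏ n g *ℕ g n)   ∎
    where open ≡mod-Reasoning d

  ∏-≡-^-mod : ∀ n {f c} → (∀ i → i < n → + f i ≡ c mod d) → + ∏ n f ≡ c ^ n mod d
  ∏-≡-^-mod zero    f≡c = ≡mod-refl
  ∏-≡-^-mod (suc n) {f} {c} f≡c = begin
    + (∏ n f *ℕ f n)   ≡⟨ ℤ.pos-* (∏ n f) (f n) ⟩
    + ∏ n f * + f n    ≈⟨ *-cong-mod (∏-≡-^-mod n (λ i i<n → f≡c i (ℕ.m<n⇒m<1+n i<n))) (f≡c n ℕ.≤-refl) ⟩
    c ^ n * c          ≡⟨ ℤ.*-comm (c ^ n) c ⟩
    c ^ suc n          ∎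
    where open ≡mod-Reasoning d

∏-indivisible : ∀ {p} → Prime p → ∀ n {f} → (∀ i → i < n → ¬ p ℕ.∣ f i) → ¬ p ℕ.∣ ∏ n f
∏-indivisible p-prime zero    p∤f p∣1 = ¬prime[1] (subst Prime (ℕ.∣1⇒≡1 p∣1) p-prime)
∏-indivisible p-prime (suc n) {f} p∤f p∣∏ with euclidsLemma (∏ n f) (f n) p-prime p∣∏
... | inj₁ p∣∏n = ∏-indivisible p-prime n (λ i i<n → p∤f i (ℕ.m<n⇒m<1+n i<n)) p∣∏n
... | inj₂ p∣fn = p∤f n ℕ.≤-refl p∣fn

!-split : ∀ a b → (a +ℕ b) ! ≡ a ! *ℕ ∏ b (λ i → a +ℕ suc i)
!-split a zero    = trans (cong _! (ℕ.+-identityʳ a)) (sym (ℕ.*-identityʳ (a !)))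
!-split a (suc b) = begin
  (a +ℕ suc b) !                      ≡⟨ cong _! (ℕ.+-suc a b) ⟩
  suc (a +ℕ b) *ℕ (a +ℕ b) !           ≡⟨ cong (suc (a +ℕ b) *ℕ_) (!-split a b) ⟩
  suc (a +ℕ b) *ℕ (a ! *ℕ F)           ≡⟨ rotate (suc (a +ℕ b)) (a !) F ⟩
  a ! *ℕ (F *ℕ suc (a +ℕ b))           ≡⟨ cong (λ k → a ! *ℕ (F *ℕ k)) (ℕ.+-suc a b) ⟨
  a ! *ℕ ∏ (suc b) (λ i → a +ℕ suc i)  ∎
  where
  open ≡-Reasoning
  F : ℕ
  F = ∏ b (λ i → a +ℕ suc i)
  rotate : ∀ x y z → x *ℕ (y *ℕ z) ≡ y *ℕ (z *ℕ x)
  rotate = ℕ-solve-∀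

!≡∏ : ∀ n → n ! ≡ ∏ n suc
!≡∏ n = trans (!-split 0 n) (ℕ.*-identityˡ _)

-- block d j = (jd + 1)(jd + 2) ⋯ (jd + d - 1), so blockFactorial d m is the product
-- of the integers in [1, md] that are not multiples of d.
block : ℕ → ℕ → ℕ
block d j = ∏ (pred d) (λ i → j *ℕ d +ℕ suc i)

blockFactorial : ℕ → ℕ → ℕ
blockFactorial d m = ∏ m (block d)

!-blocks : ∀ d .{{_ : NonZero d}} m → (m *ℕ d) ! ≡ blockFactorial d m *ℕ (d ^ℕ m *ℕ m !)
!-blocks d         zero    = refl
!-blocks d@(suc _) (suc m) = begin
  (d +ℕ m *ℕ d) !                          ≡⟨ cong _! (ℕ.+-comm d (m *ℕ d)) ⟩
  (m *ℕ d +ℕ d) !                          ≡⟨ !-split (m *ℕ d) d ⟩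
  (m *ℕ d) ! *ℕ (B *ℕ (m *ℕ d +ℕ d))         ≡⟨ cong (_*ℕ (B *ℕ (m *ℕ d +ℕ d))) (!-blocks d m) ⟩
  G *ℕ (d ^ℕ m *ℕ m !) *ℕ (B *ℕ (m *ℕ d +ℕ d)) ≡⟨ regroup G B (d ^ℕ m) (m !) m d ⟩
  G *ℕ B *ℕ (d ^ℕ suc m *ℕ suc m !)          ∎
  where
  open ≡-Reasoning
  B G : ℕ
  B = block d m
  G = blockFactorial d m
  regroup : ∀ G B D F m d → G *ℕ (D *ℕ F) *ℕ (B *ℕ (m *ℕ d +ℕ d)) ≡ G *ℕ B *ℕ (d *ℕ D *ℕ ((1 +ℕ m) *ℕ F))
  regroup = ℕ-solve-∀

block-indivisible : ∀ {p} → Prime p → ∀ j → ¬ p ℕ.∣ block p j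
block-indivisible {p@(suc _)} p-prime j =
  ∏-indivisible p-prime (pred p) λ i i<p-1 p∣jp+1+i →
    ℕ.<⇒≱ (s≤s i<p-1) (ℕ.∣⇒≤ (ℕ.∣m+n∣m⇒∣n p∣jp+1+i (ℕ.n∣m*n j)))

record UnitDecomposition (p n u : ℕ) : Set where
  field
    valuation : ℕ
    n≡p^ν*u   : n ≡ p ^ℕ valuation *ℕ u
    p∤u       : ¬ p ℕ.∣ u

module _ {p : ℕ} .{{_ : NonTrivial p}} where

  unitPartAux-decomposition : ∀ fuel n .{{_ : NonZero n}} → n ≤ fuel →
                              UnitDecomposition p n (unitPartAux p fuel n)
  unitPartAux-decomposition (suc fuel) (suc m) n≤fuel with p ℕ.∣? suc m
  ... | no p∤n = record { valuation = 0 ; n≡p^ν*u = sym (ℕ.*-identityˡ (suc m)) ; p∤u = p∤n }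
  ... | yes (ℕ.divides q@(suc _) n≡qp) = record
    { valuation = suc valuation
    ; n≡p^ν*u   = begin
        suc m                    ≡⟨ n≡qp ⟩
        q *ℕ p                    ≡⟨ cong (_*ℕ p) n≡p^ν*u ⟩
        p ^ℕ valuation *ℕ u *ℕ p   ≡⟨ move-p (p ^ℕ valuation) u p ⟩
        p ^ℕ suc valuation *ℕ u    ∎
    ; p∤u       = p∤u
    }
    where
    open ≡-Reasoning
    u : ℕ
    u = unitPartAux p fuel q
    q<n : q < suc m
    q<n = subst (q <_) (sym n≡qp) (ℕ.m<m*n q p (ℕ.nonTrivial⇒n>1 p))
    open UnitDecomposition (unitPartAux-decomposition fuel q (ℕ.≤-trans (ℕ.≤-pred q<n) (ℕ.≤-pred n≤fuel)))
    move-p : ∀ P u p → P *ℕ u *ℕ p ≡ p *ℕ P *ℕ u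
    move-p = ℕ-solve-∀

  unitPart-decomposition : ∀ n .{{_ : NonZero n}} → UnitDecomposition p n (unitPart p n)
  unitPart-decomposition n = unitPartAux-decomposition n n ℕ.≤-refl

module _ {p : ℕ} .{{_ : NonZero p}} where

  p^v*u-cancel : ∀ v w {u u′} → p ^ℕ v *ℕ u ≡ p ^ℕ w *ℕ u′ → ¬ p ℕ.∣ u → ¬ p ℕ.∣ u′ → u ≡ u′
  p^v*u-cancel zero    zero    {u} {u′} eq _ _ = trans (sym (ℕ.*-identityˡ u)) (trans eq (ℕ.*-identityˡ u′))
  p^v*u-cancel zero    (suc w) {u} {u′} eq p∤u _ =
    contradiction (subst (p ℕ.∣_) (trans (sym eq) (ℕ.*-identityˡ u)) (ℕ.∣m⇒∣m*n u′ (ℕ.m∣m*n (p ^ℕ w)))) p∤u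
  p^v*u-cancel (suc v) zero    eq p∤u p∤u′ = sym (p^v*u-cancel zero (suc v) (sym eq) p∤u′ p∤u)
  p^v*u-cancel (suc v) (suc w) {u} {u′} eq =
    p^v*u-cancel v w
      (ℕ.*-cancelˡ-≡ _ _ p (trans (sym (ℕ.*-assoc p (p ^ℕ v) u)) (trans eq (ℕ.*-assoc p (p ^ℕ w) u′))))

  UnitDecomposition-unique : ∀ {n u u′} → UnitDecomposition p n u → UnitDecomposition p n u′ → u ≡ u′
  UnitDecomposition-unique d d′ =
    p^v*u-cancel (valuation d) (valuation d′) (trans (sym (n≡p^ν*u d)) (n≡p^ν*u d′)) (p∤u d) (p∤u d′)
    where open UnitDecomposition

unitPart-unique : ∀ {p n u} .{{_ : NonTrivial p}} .{{_ : NonZero n}} →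
                  UnitDecomposition p n u → unitPart p n ≡ u
unitPart-unique {p} {n} = UnitDecomposition-unique {{ℕ.nonTrivial⇒nonZero p}} (unitPart-decomposition n)

unitPart-[m*p]! : ∀ {p} → Prime p → ∀ m → unitPart p ((m *ℕ p) !) ≡ blockFactorial p m *ℕ unitPart p (m !)
unitPart-[m*p]! {p} p-prime m = unitPart-unique record
  { valuation = m +ℕ valuation
  ; n≡p^ν*u   = begin
      (m *ℕ p) !                              ≡⟨ !-blocks p m ⟩
      G *ℕ (p ^ℕ m *ℕ m !)                     ≡⟨ cong (λ k → G *ℕ (p ^ℕ m *ℕ k)) n≡p^ν*u ⟩
      G *ℕ (p ^ℕ m *ℕ (p ^ℕ valuation *ℕ u))    ≡⟨ regroup G (p ^ℕ m) (p ^ℕ valuation) u ⟩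
      p ^ℕ m *ℕ p ^ℕ valuation *ℕ (G *ℕ u)      ≡⟨ cong (_*ℕ (G *ℕ u)) (ℕ.^-distribˡ-+-* p m valuation) ⟨
      p ^ℕ (m +ℕ valuation) *ℕ (G *ℕ u)         ∎
  ; p∤u       = λ p∣Gu → [ G-indivisible , p∤u ]′ (euclidsLemma G u p-prime p∣Gu)
  }
  where
  open ≡-Reasoning
  instance
    p≢0 : NonZero p
    p≢0 = ℕ.nonTrivial⇒nonZero p
    [mp]!≢0 : NonZero ((m *ℕ p) !)
    [mp]!≢0 = (m *ℕ p) ℕ.!≢0
    m!≢0 : NonZero (m !)
    m!≢0 = m ℕ.!≢0
  G u : ℕ
  G = blockFactorial p m
  u = unitPart p (m !)
  G-indivisible : ¬ p ℕ.∣ G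
  G-indivisible = ∏-indivisible p-prime m (λ j _ → block-indivisible p-prime j)
  open UnitDecomposition (unitPart-decomposition (m !))
  regroup : ∀ G P Q u → G *ℕ (P *ℕ (Q *ℕ u)) ≡ P *ℕ Q *ℕ (G *ℕ u)
  regroup = ℕ-solve-∀

-- Wilson's theorem

module _ {p : ℕ} (p-prime : Prime p) where

  ℤ-euclidsLemma : ∀ x y → + p ∣ x * y → + p ∣ x ⊎ + p ∣ y
  ℤ-euclidsLemma x y p∣xy = Sum.map ∣ᵤ⇒∣ ∣ᵤ⇒∣
    (euclidsLemma (abs x) (abs y) p-prime (subst (p ℕ.∣_) (ℤ.abs-* x y) (∣⇒∣ᵤ p∣xy)))

  square≡1⇒≡±1 : ∀ x → x * x ≡ 1ℤ mod p → x ≡ 1ℤ mod p ⊎ x ≡ -1ℤ mod p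
  square≡1⇒≡±1 x (≡mod p∣x²-1) =
    Sum.map ≡mod (λ p∣x+1 → ≡mod (subst (+ p ∣_) (plus x) p∣x+1))
      (ℤ-euclidsLemma (x - 1ℤ) (x + 1ℤ) (subst (+ p ∣_) (factor x) p∣x²-1))
    where
    factor : ∀ x → x * x - 1ℤ ≡ (x - 1ℤ) * (x + 1ℤ)
    factor = solve-∀
    plus : ∀ x → x + 1ℤ ≡ x - -1ℤ
    plus = solve-∀

  inverse-mod : ∀ x .{{_ : NonZero x}} → x < p → ∃[ y ] y < p × + x * + y ≡ 1ℤ mod p
  inverse-mod x x<p =
    y %ℕ p , ℤ.n%ℕd<d y p , ≡mod-trans (*-cong-mod (≡mod-refl {x = + x}) (≡mod-sym (≡mod-%ℕ p y))) xy≡1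
    where
    instance
      p≢0 : NonZero p
      p≢0 = ℕ.nonTrivial⇒nonZero p
    inverse : ∃[ y ] + x * y ≡ 1ℤ mod p
    inverse with coprime-Bézout (prime⇒coprime p-prime x<p)
    ... | Bézout.+- a b 1+bx≡ap = - + b , ≡mod (divides (- + a) (begin
      + x * - + b - 1ℤ     ≡⟨ negate (+ x) (+ b) ⟩
      - (1ℤ + + b * + x)   ≡⟨ cong (λ z → - (1ℤ + z)) (ℤ.pos-* b x) ⟨
      - + (1 +ℕ b *ℕ x)    ≡⟨ cong (λ z → - + z) 1+bx≡ap ⟩
      - + (a *ℕ p)         ≡⟨ cong -_ (ℤ.pos-* a p) ⟩
      - (+ a * + p)        ≡⟨ ℤ.neg-distribˡ-* (+ a) (+ p) ⟩
      - + a * + p          ∎))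
      where
      open ≡-Reasoning
      negate : ∀ x b → x * - b - 1ℤ ≡ - (1ℤ + b * x)
      negate = solve-∀
    ... | Bézout.-+ a b 1+ap≡bx = + b , ≡mod (divides (+ a) (begin
      + x * + b - 1ℤ        ≡⟨ cong (_- 1ℤ) (ℤ.*-comm (+ x) (+ b)) ⟩
      + b * + x - 1ℤ        ≡⟨ cong (_- 1ℤ) (ℤ.pos-* b x) ⟨
      + (b *ℕ x) - 1ℤ       ≡⟨ cong (λ z → + z - 1ℤ) 1+ap≡bx ⟨
      + (1 +ℕ a *ℕ p) - 1ℤ  ≡⟨ cong (λ z → 1ℤ + z - 1ℤ) (ℤ.pos-* a p) ⟩
      1ℤ + + a * + p - 1ℤ   ≡⟨ cancel (+ a * + p) ⟩
      + a * + p             ∎))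
      where
      open ≡-Reasoning
      cancel : ∀ z → 1ℤ + z - 1ℤ ≡ z
      cancel = solve-∀
    y : ℤ
    y = proj₁ inverse
    xy≡1 : + x * y ≡ 1ℤ mod p
    xy≡1 = proj₂ inverse

module _ {n : ℕ} where

  -- Remove x and its partner y; a partner w of a remaining element z is neither
  -- x (then z = y by cancellation) nor y (then z = x), so the rest stays paired.
  product-paired≡1 : ∀ fuel xs → length xs ≤ fuel → Unique xs →
    (∀ {x} → x ∈ xs → ∃[ y ] y ∈ xs × y ≢ x × + x * + y ≡ 1ℤ mod n) →
    (∀ {x y z} → x ∈ xs → y ∈ xs → + x * + z ≡ 1ℤ mod n → + y * + z ≡ 1ℤ mod n → x ≡ y) →
    + product xs ≡ 1ℤ mod n
  product-paired≡1 _          []       _ _ _ _ = ≡mod-refl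
  product-paired≡1 (suc fuel) (x ∷ ys) (s≤s |ys|≤fuel) unique partner cancel
    with partner (here refl)
  ... | y , here refl , y≢x , _ = contradiction refl y≢x
  ... | y , there y∈ys , _ , xy≡1 with as , bs , refl ← ∈-∃++ y∈ys = begin
    + (x *ℕ product (as ++ [ y ] ++ bs))  ≡⟨ cong (λ P → + (x *ℕ P)) (product-↭ π) ⟩
    + (x *ℕ (y *ℕ product zs))            ≡⟨ pos-*³ x y (product zs) ⟩
    + x * + y * + product zs              ≈⟨ *-cong-mod xy≡1 product-zs≡1 ⟩
    1ℤ * 1ℤ                               ≡⟨⟩
    1ℤ                                    ∎
    where
    open ≡mod-Reasoning n
    zs : List ℕ
    zs = as ++ bs
    π : as ++ [ y ] ++ bs ↭ y ∷ zs
    π = shift y as bs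
    pos-*³ : ∀ a b c → + (a *ℕ (b *ℕ c)) ≡ + a * + b * + c
    pos-*³ a b c =
      trans (ℤ.pos-* a (b *ℕ c)) (trans (cong (+ a *_) (ℤ.pos-* b c)) (sym (ℤ.*-assoc (+ a) (+ b) (+ c))))
    zs→ys : ∀ {z} → z ∈ zs → z ∈ as ++ [ y ] ++ bs
    zs→ys = ∈-resp-↭ (↭-sym π) ∘ there
    zs→xs : ∀ {z} → z ∈ zs → z ∈ x ∷ as ++ [ y ] ++ bs
    zs→xs = there ∘ zs→ys
    y∈xs : y ∈ x ∷ as ++ [ y ] ++ bs
    y∈xs = there (∈-resp-↭ (↭-sym π) (here refl))
    unique-yzs : Unique (y ∷ zs)
    unique-yzs = Unique-resp-↭ (↭⇒↭ₛ π) (Unique.tail unique)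
    y∉zs : y ∉ zs
    y∉zs = Unique[x∷xs]⇒x∉xs unique-yzs
    x∉zs : x ∉ zs
    x∉zs = Unique[x∷xs]⇒x∉xs unique ∘ zs→ys
    yx≡1 : + y * + x ≡ 1ℤ mod n
    yx≡1 = ≡mod-trans (≡⇒≡mod (ℤ.*-comm (+ y) (+ x))) xy≡1
    partner-zs : ∀ {z} → z ∈ zs → ∃[ w ] w ∈ zs × w ≢ z × + z * + w ≡ 1ℤ mod n
    partner-zs {z} z∈zs with partner (zs→xs z∈zs)
    ... | w , here refl , _ , zx≡1 =
      contradiction (subst (_∈ zs) (cancel (zs→xs z∈zs) y∈xs zx≡1 yx≡1) z∈zs) y∉zs
    ... | w , there w∈ys , w≢z , zw≡1 with ∈-resp-↭ π w∈ys
    ...   | here refl  = contradiction (subst (_∈ zs) (cancel (zs→xs z∈zs) (here refl) zw≡1 xy≡1) z∈zs) x∉zs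
    ...   | there w∈zs = w , w∈zs , w≢z , zw≡1
    product-zs≡1 : + product zs ≡ 1ℤ mod n
    product-zs≡1 = product-paired≡1 fuel zs
      (ℕ.≤-trans (ℕ.n≤1+n _) (subst (_≤ fuel) (↭-length π) |ys|≤fuel)) (Unique.tail unique-yzs)
      partner-zs (λ x∈zs y∈zs → cancel (zs→xs x∈zs) (zs→xs y∈zs))

[1+n]!≡product : ∀ n → suc n ! ≡ product (applyDownFrom (2 +ℕ_) n)
[1+n]!≡product zero    = refl
[1+n]!≡product (suc n) = cong ((2 +ℕ n) *ℕ_) ([1+n]!≡product n)

module _ {r : ℕ} (p-prime : Prime (3 +ℕ r)) where

  private
    p : ℕ
    p = 3 +ℕ r
    p-1≡-1 : + (2 +ℕ r) ≡ -1ℤ mod p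
    p-1≡-1 = +n≡-1 (2 +ℕ r)

  middleResidues : List ℕ
  middleResidues = applyDownFrom (2 +ℕ_) r

  middleResidue-≢±1 : ∀ {i} → i < r → ¬ (+ (2 +ℕ i) ≡ 1ℤ mod p) × ¬ (+ (2 +ℕ i) ≡ -1ℤ mod p)
  middleResidue-≢±1 {i} i<r =
    (λ x≡1 → contradiction (+-injective-mod x<p (s≤s (s≤s z≤n)) x≡1) λ ()) ,
    (λ x≡-1 → ℕ.<⇒≢ (s≤s (s≤s i<r)) (+-injective-mod x<p ℕ.≤-refl (≡mod-trans x≡-1 (≡mod-sym p-1≡-1))))
    where
    x<p : 2 +ℕ i < p
    x<p = s≤s (s≤s (ℕ.m<n⇒m<1+n i<r))

  middleResidue-inverse : ∀ {x} → x ∈ middleResidues →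
    ∃[ y ] y ∈ middleResidues × y ≢ x × + x * + y ≡ 1ℤ mod p
  middleResidue-inverse x∈ with i , i<r , refl ← ∈-applyDownFrom⁻ (2 +ℕ_) x∈ =
    classify (inverse-mod p-prime (2 +ℕ i) (s≤s (s≤s (ℕ.m<n⇒m<1+n i<r))))
    where
    x : ℕ
    x = 2 +ℕ i
    classify : ∃[ y ] y < p × + x * + y ≡ 1ℤ mod p →
               ∃[ y ] y ∈ middleResidues × y ≢ x × + x * + y ≡ 1ℤ mod p
    classify (zero , _ , x*0≡1) =
      contradiction (+-injective-mod {x = 0} {y = 1} (s≤s z≤n) (s≤s (s≤s z≤n)) 0≡1) λ ()
      where
      0≡1 : + 0 ≡ + 1 mod p
      0≡1 = ≡mod-trans (≡⇒≡mod (sym (ℤ.*-zeroʳ (+ x)))) x*0≡1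
    classify (suc zero , _ , x*1≡1) =
      contradiction (≡mod-trans (≡⇒≡mod (sym (ℤ.*-identityʳ (+ x)))) x*1≡1) (proj₁ (middleResidue-≢±1 i<r))
    classify (suc (suc j) , y<p , xy≡1) = 2 +ℕ j , ∈-applyDownFrom⁺ (2 +ℕ_) j<r , y≢x , xy≡1
      where
      j<r : j < r
      j<r = ℕ.≤∧≢⇒< (ℕ.≤-pred (ℕ.≤-pred (ℕ.≤-pred y<p))) λ { refl →
        proj₂ (middleResidue-≢±1 i<r)
          (inverse-mod-unique {y = -1ℤ} xy≡1 (*-cong-mod (≡mod-refl {x = -1ℤ}) p-1≡-1)) }
      y≢x : 2 +ℕ j ≢ x
      y≢x refl = [ proj₁ (middleResidue-≢±1 i<r) , proj₂ (middleResidue-≢±1 i<r) ]′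
        (square≡1⇒≡±1 p-prime (+ x) xy≡1)

  middleResidue-inverse-unique : ∀ {x y z} → x ∈ middleResidues → y ∈ middleResidues →
    + x * + z ≡ 1ℤ mod p → + y * + z ≡ 1ℤ mod p → x ≡ y
  middleResidue-inverse-unique x∈ y∈ xz≡1 yz≡1 =
    +-injective-mod (<p x∈) (<p y∈) (inverse-mod-unique xz≡1 yz≡1)
    where
    <p : ∀ {x} → x ∈ middleResidues → x < p
    <p x∈ with i , i<r , refl ← ∈-applyDownFrom⁻ (2 +ℕ_) x∈ = s≤s (s≤s (ℕ.m<n⇒m<1+n i<r))

  product-middleResidues≡1 : + product middleResidues ≡ 1ℤ mod p
  product-middleResidues≡1 =
    product-paired≡1 (length middleResidues) middleResidues ℕ.≤-refl
      (applyDownFrom⁺₁ (2 +ℕ_) r (λ j<i _ 2+i≡2+j → ℕ.<⇒≢ j<i (sym (cong (pred ∘ pred) 2+i≡2+j))))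
      middleResidue-inverse middleResidue-inverse-unique

wilson : ∀ {p} → Prime p → + (pred p !) ≡ -1ℤ mod p
wilson {2}                     _       = ≡mod (divides 1ℤ refl)
wilson {p@(suc (suc (suc r)))} p-prime = begin
  + ((2 +ℕ r) *ℕ suc r !)                            ≡⟨ ℤ.pos-* (2 +ℕ r) (suc r !) ⟩
  + (2 +ℕ r) * + (suc r !)                           ≡⟨ cong (λ k → + (2 +ℕ r) * + k) ([1+n]!≡product r) ⟩
  + (2 +ℕ r) * + product (applyDownFrom (2 +ℕ_) r)
    ≈⟨ *-cong-mod (+n≡-1 (2 +ℕ r)) (product-middleResidues≡1 p-prime) ⟩
  -1ℤ * 1ℤ                                          ≡⟨⟩
  -1ℤ                                               ∎
  where open ≡mod-Reasoning p

-- The block factorials modulo powers of p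

block≡-1 : ∀ {p} → Prime p → ∀ j → + block p j ≡ -1ℤ mod p
block≡-1 {p} p-prime j = begin
  + block p j        ≈⟨ ∏-cong-mod (pred p) (λ i _ → +[t*n+a]≡+a p j (suc i)) ⟩
  + ∏ (pred p) suc   ≡⟨ cong +_ (!≡∏ (pred p)) ⟨
  + (pred p !)       ≈⟨ wilson p-prime ⟩
  -1ℤ                ∎
  where open ≡mod-Reasoning p

blockFactorial≡±1 : ∀ {p} → Prime p → ∀ m → + blockFactorial p m ≡ -1ℤ ^ m mod p
blockFactorial≡±1 p-prime m = ∏-≡-^-mod m (λ j _ → block≡-1 p-prime j)

block-periodic : ∀ d j t P → + block d (j +ℕ t *ℕ P) ≡ + block d j mod (d *ℕ P)
block-periodic d j t P = ∏-cong-mod (pred d) λ i _ → begin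
  + ((j +ℕ t *ℕ P) *ℕ d +ℕ suc i)        ≡⟨ cong +_ (regroup j t P d (suc i)) ⟩
  + (t *ℕ (d *ℕ P) +ℕ (j *ℕ d +ℕ suc i))  ≈⟨ +[t*n+a]≡+a (d *ℕ P) t (j *ℕ d +ℕ suc i) ⟩
  + (j *ℕ d +ℕ suc i)                   ∎
  where
  open ≡mod-Reasoning (d *ℕ P)
  regroup : ∀ j t P d s → (j +ℕ t *ℕ P) *ℕ d +ℕ s ≡ t *ℕ (d *ℕ P) +ℕ (j *ℕ d +ℕ s)
  regroup = ℕ-solve-∀

blockFactorial-periodic : ∀ d c P → + blockFactorial d (c *ℕ P) ≡ (+ blockFactorial d P) ^ c mod (d *ℕ P)
blockFactorial-periodic d zero    P = ≡mod-refl
blockFactorial-periodic d (suc c) P = begin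
  + ∏ (P +ℕ c *ℕ P) B                           ≡⟨ cong (λ n → + ∏ n B) (ℕ.+-comm P (c *ℕ P)) ⟩
  + ∏ (c *ℕ P +ℕ P) B                           ≡⟨ cong +_ (∏-+ (c *ℕ P) P B) ⟩
  + (∏ (c *ℕ P) B *ℕ ∏ P B′)                     ≡⟨ ℤ.pos-* (∏ (c *ℕ P) B) (∏ P B′) ⟩
  + ∏ (c *ℕ P) B * + ∏ P B′                      ≈⟨ *-cong-mod (blockFactorial-periodic d c P) shifted ⟩
  (+ blockFactorial d P) ^ c * + blockFactorial d P  ≡⟨ ℤ.*-comm _ (+ blockFactorial d P) ⟩
  (+ blockFactorial d P) ^ suc c                     ∎
  where
  open ≡mod-Reasoning (d *ℕ P)
  B B′ : ℕ → ℕ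
  B = block d
  B′ j = block d (c *ℕ P +ℕ j)
  shifted : + ∏ P B′ ≡ + blockFactorial d P mod (d *ℕ P)
  shifted = ∏-cong-mod P λ j _ →
    ≡mod-trans (≡⇒≡mod (cong (λ i → + block d i) (ℕ.+-comm (c *ℕ P) j))) (block-periodic d j c P)

-- Lifting congruences to higher powers of p

geometric : ℤ → ℤ → ℕ → ℤ
geometric x y zero    = 0ℤ
geometric x y (suc n) = x ^ n + y * geometric x y n

^-^≡-*geometric : ∀ x y n → x ^ n - y ^ n ≡ (x - y) * geometric x y n
^-^≡-*geometric x y zero    = base x y
  where
  base : ∀ x y → 1ℤ - 1ℤ ≡ (x - y) * 0ℤ
  base = solve-∀
^-^≡-*geometric x y (suc n) = begin
  x * x ^ n - y * y ^ n                              ≡⟨ split x y (x ^ n) (y ^ n) ⟩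
  (x - y) * x ^ n + y * (x ^ n - y ^ n)              ≡⟨ cong (λ z → (x - y) * x ^ n + y * z) (^-^≡-*geometric x y n) ⟩
  (x - y) * x ^ n + y * ((x - y) * geometric x y n)  ≡⟨ factor x y (x ^ n) (geometric x y n) ⟩
  (x - y) * geometric x y (suc n)                    ∎
  where
  open ≡-Reasoning
  split : ∀ x y X Y → x * X - y * Y ≡ (x - y) * X + y * (X - Y)
  split = solve-∀
  factor : ∀ x y X S → (x - y) * X + y * ((x - y) * S) ≡ (x - y) * (X + y * S)
  factor = solve-∀

geometric-≡mod : ∀ {d x y} → x ≡ y mod d → ∀ n → geometric x y (suc n) ≡ + suc n * y ^ n mod d
geometric-≡mod {y = y} x≡y zero    = ≡⇒≡mod (base y)
  where
  base : ∀ y → 1ℤ + y * 0ℤ ≡ 1ℤ * 1ℤ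
  base = solve-∀
geometric-≡mod {d} {x} {y} x≡y (suc n) = begin
  x ^ suc n + y * geometric x y (suc n)
    ≈⟨ +-cong-mod (^-cong-mod (suc n) x≡y) (*-cong-mod (≡mod-refl {x = y}) (geometric-≡mod x≡y n)) ⟩
  y ^ suc n + y * (+ suc n * y ^ n)       ≡⟨ collect y (y ^ n) (+ suc n) ⟩
  (1ℤ + + suc n) * y ^ suc n              ∎
  where
  open ≡mod-Reasoning d
  collect : ∀ y Y c → y * Y + y * (c * Y) ≡ (1ℤ + c) * (y * Y)
  collect = solve-∀

∣geometric : ∀ {d x y} → x ≡ y mod d → + d ∣ geometric x y d
∣geometric {zero}          _   = divides 0ℤ refl
∣geometric {suc n} {x} {y} x≡y =
  subst (+ suc n ∣_) (cancel (geometric x y (suc n)) (+ suc n * y ^ n))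
    (∣m∣n⇒∣m+n (n∣x-y (geometric-≡mod x≡y n)) (∣m⇒∣m*n (y ^ n) ∣-refl))
  where
  cancel : ∀ g c → g - c + c ≡ g
  cancel = solve-∀

^p-≡mod : ∀ {p m x y} → p ℕ.∣ m → x ≡ y mod m → x ^ p ≡ y ^ p mod (p *ℕ m)
^p-≡mod {p} {m} {x} {y} p∣m x≡y@(≡mod m∣x-y) = ≡mod (subst₂ _∣_ mp≡pm (sym (^-^≡-*geometric x y p))
  (∣-trans (*-monoʳ-∣ (+ m) (∣geometric (≡mod-∣ p∣m x≡y))) (*-monoˡ-∣ (geometric x y p) m∣x-y)))
  where
  mp≡pm : + m * + p ≡ + (p *ℕ m)
  mp≡pm = trans (ℤ.*-comm (+ m) (+ p)) (sym (ℤ.pos-* p m))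

^p^-≡mod : ∀ {p x y} k → x ≡ y mod p → x ^ (p ^ℕ k) ≡ y ^ (p ^ℕ k) mod (p ^ℕ suc k)
^p^-≡mod {p}         zero    x≡y = ≡mod-∣ (ℕ.∣-reflexive (ℕ.*-identityʳ p)) (*-cong-mod x≡y ≡mod-refl)
^p^-≡mod {p} {x} {y} (suc k) x≡y =
  subst₂ (λ u v → u ≡ v mod (p ^ℕ suc (suc k))) (^-^ x) (^-^ y)
    (^p-≡mod {p} (ℕ.m∣m*n (p ^ℕ k)) (^p^-≡mod k x≡y))
  where
  ^-^ : ∀ z → (z ^ (p ^ℕ k)) ^ p ≡ z ^ (p ^ℕ suc k)
  ^-^ z = trans (ℤ.^-*-assoc z (p ^ℕ k) p) (cong (z ^_) (ℕ.*-comm (p ^ℕ k) p))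

^-monoʳ-∣ : ∀ p {m n} → m ≤ n → p ^ℕ m ℕ.∣ p ^ℕ n
^-monoʳ-∣ p {m} m≤n with k , refl ← ℕ.m≤n⇒∃[o]m+o≡n m≤n =
  ℕ.divides (p ^ℕ k) (trans (ℕ.^-distribˡ-+-* p m k) (ℕ.*-comm (p ^ℕ m) (p ^ℕ k)))

-1^[n+n]≡1 : ∀ n → -1ℤ ^ (n +ℕ n) ≡ 1ℤ
-1^[n+n]≡1 zero    = refl
-1^[n+n]≡1 (suc n) = begin
  -1ℤ * -1ℤ ^ (n +ℕ suc n)       ≡⟨ cong (λ k → -1ℤ * -1ℤ ^ k) (ℕ.+-suc n n) ⟩
  -1ℤ * (-1ℤ * -1ℤ ^ (n +ℕ n))   ≡⟨ cancel (-1ℤ ^ (n +ℕ n)) ⟩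
  -1ℤ ^ (n +ℕ n)                 ≡⟨ -1^[n+n]≡1 n ⟩
  1ℤ                             ∎
  where
  open ≡-Reasoning
  cancel : ∀ x → -1ℤ * (-1ℤ * x) ≡ x
  cancel = solve-∀

-1^[n*n]≡-1^n : ∀ n → -1ℤ ^ (n *ℕ n) ≡ -1ℤ ^ n
-1^[n*n]≡-1^n zero    = refl
-1^[n*n]≡-1^n (suc n) = begin
  -1ℤ ^ (suc n *ℕ suc n)                    ≡⟨ cong (-1ℤ ^_) (square n) ⟩
  -1ℤ ^ ((n +ℕ n) +ℕ suc (n *ℕ n))          ≡⟨ ℤ.^-distribˡ-+-* -1ℤ (n +ℕ n) (suc (n *ℕ n)) ⟩
  -1ℤ ^ (n +ℕ n) * (-1ℤ * -1ℤ ^ (n *ℕ n))   ≡⟨ cong₂ (λ a b → a * (-1ℤ * b)) (-1^[n+n]≡1 n) (-1^[n*n]≡-1^n n) ⟩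
  1ℤ * -1ℤ ^ suc n                         ≡⟨ ℤ.*-identityˡ _ ⟩
  -1ℤ ^ suc n                              ∎
  where
  open ≡-Reasoning
  square : ∀ n → suc n *ℕ suc n ≡ (n +ℕ n) +ℕ suc (n *ℕ n)
  square = ℕ-solve-∀

-1^[n^[1+e]*m]≡-1^[n*m] : ∀ n e m → -1ℤ ^ (n ^ℕ suc e *ℕ m) ≡ -1ℤ ^ (n *ℕ m)
-1^[n^[1+e]*m]≡-1^[n*m] n zero    m = cong (λ k → -1ℤ ^ (k *ℕ m)) (ℕ.*-identityʳ n)
-1^[n^[1+e]*m]≡-1^[n*m] n (suc e) m = begin
  -1ℤ ^ (n *ℕ n ^ℕ suc e *ℕ m)     ≡⟨ cong (-1ℤ ^_) (regroup n (n ^ℕ suc e) m) ⟩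
  -1ℤ ^ (n ^ℕ suc e *ℕ (n *ℕ m))   ≡⟨ -1^[n^[1+e]*m]≡-1^[n*m] n e (n *ℕ m) ⟩
  -1ℤ ^ (n *ℕ (n *ℕ m))           ≡⟨ cong (-1ℤ ^_) (ℕ.*-assoc n n m) ⟨
  -1ℤ ^ (n *ℕ n *ℕ m)             ≡⟨ ℤ.^-*-assoc -1ℤ (n *ℕ n) m ⟨
  (-1ℤ ^ (n *ℕ n)) ^ m            ≡⟨ cong (_^ m) (-1^[n*n]≡-1^n n) ⟩
  (-1ℤ ^ n) ^ m                   ≡⟨ ℤ.^-*-assoc -1ℤ n m ⟩
  -1ℤ ^ (n *ℕ m)                  ∎
  where
  open ≡-Reasoning
  regroup : ∀ n N m → n *ℕ N *ℕ m ≡ N *ℕ (n *ℕ m)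
  regroup = ℕ-solve-∀

module _ {p : ℕ} (a : ℕ → ℤ) (N : ℕ → ℕ) (N-mono : ∀ k → N k ≤ N (suc k))
         (step : ∀ k e → N k ≤ e → a (suc e) ≡ a e mod p ^ℕ k) where

  ≥N⇒≡a[N] : ∀ k e → N k ≤ e → a e ≡ a (N k) mod p ^ℕ k
  ≥N⇒≡a[N] k e N≤e = subst (λ i → a i ≡ a (N k) mod p ^ℕ k) (ℕ.m∸n+n≡m N≤e) (shifted (e ∸ N k))
    where
    shifted : ∀ d → a (d +ℕ N k) ≡ a (N k) mod p ^ℕ k
    shifted zero    = ≡mod-refl
    shifted (suc d) = ≡mod-trans (step k (d +ℕ N k) (ℕ.m≤n+m (N k) d)) (shifted d)

  cauchy⇒hasLimit : HasLimit p a
  cauchy⇒hasLimit =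
    record { seq = a ∘ N ; coh = λ k → ∣⇒∣ᵤ (n∣x-y (≥N⇒≡a[N] k (N (suc k)) (N-mono k))) } ,
    λ k → N k , λ e N≤e → ∣⇒∣ᵤ (n∣x-y (≥N⇒≡a[N] k e N≤e))

module _ {p : ℕ} (p-prime : Prime p) (α : ℕ) where

  -- With e = k + n and αpᵉ = (αpⁿ)·pᵏ, periodicity gives the congruence mod pᵏ⁺¹ and
  -- lifting gives it mod pⁿ⁺¹; hence the condition 2k ≤ e.
  blockFactorial-α*p^e≡±1 : ∀ k e → k +ℕ k ≤ e →
    + blockFactorial p (α *ℕ p ^ℕ e) ≡ -1ℤ ^ (α *ℕ p ^ℕ e) mod p ^ℕ suc k
  blockFactorial-α*p^e≡±1 k e k+k≤e
    with n , refl ← ℕ.m≤n⇒∃[o]m+o≡n (ℕ.≤-trans (ℕ.m≤m+n k k) k+k≤e) = begin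
    + blockFactorial p (α *ℕ p ^ℕ (k +ℕ n))   ≡⟨ cong (λ m → + blockFactorial p m) regroup ⟩
    + blockFactorial p (α *ℕ p ^ℕ n *ℕ P)     ≈⟨ blockFactorial-periodic p (α *ℕ p ^ℕ n) P ⟩
    G ^ (α *ℕ p ^ℕ n)                        ≡⟨ ℤ.^-*-assoc G α (p ^ℕ n) ⟨
    (G ^ α) ^ (p ^ℕ n)                       ≈⟨ ≡mod-∣ (^-monoʳ-∣ p (s≤s k≤n)) (^p^-≡mod n G^α≡±1) ⟩
    ((-1ℤ ^ P) ^ α) ^ (p ^ℕ n)               ≡⟨ cong (_^ (p ^ℕ n)) (ℤ.^-*-assoc -1ℤ P α) ⟩
    (-1ℤ ^ (P *ℕ α)) ^ (p ^ℕ n)              ≡⟨ ℤ.^-*-assoc -1ℤ (P *ℕ α) (p ^ℕ n) ⟩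
    -1ℤ ^ (P *ℕ α *ℕ p ^ℕ n)                 ≡⟨ cong (-1ℤ ^_) regroup′ ⟩
    -1ℤ ^ (α *ℕ p ^ℕ (k +ℕ n))               ∎
    where
    open ≡mod-Reasoning (p ^ℕ suc k)
    P : ℕ
    P = p ^ℕ k
    G : ℤ
    G = + blockFactorial p P
    k≤n : k ≤ n
    k≤n = ℕ.+-cancelˡ-≤ k k n k+k≤e
    G^α≡±1 : G ^ α ≡ (-1ℤ ^ P) ^ α mod p
    G^α≡±1 = ^-cong-mod α (blockFactorial≡±1 p-prime P)
    regroup : α *ℕ p ^ℕ (k +ℕ n) ≡ α *ℕ p ^ℕ n *ℕ P
    regroup = trans (cong (α *ℕ_) (ℕ.^-distribˡ-+-* p k n)) (swap α P (p ^ℕ n))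
      where
      swap : ∀ α P Q → α *ℕ (P *ℕ Q) ≡ α *ℕ Q *ℕ P
      swap = ℕ-solve-∀
    regroup′ : P *ℕ α *ℕ p ^ℕ n ≡ α *ℕ p ^ℕ (k +ℕ n)
    regroup′ = trans (swap P α (p ^ℕ n)) (cong (α *ℕ_) (sym (ℕ.^-distribˡ-+-* p k n)))
      where
      swap : ∀ P α Q → P *ℕ α *ℕ Q ≡ α *ℕ (P *ℕ Q)
      swap = ℕ-solve-∀

  unitFactorial : ℕ → ℕ
  unitFactorial e = unitPart p ((α *ℕ p ^ℕ e) !)

  signedUnitFactorial : ℕ → ℤ
  signedUnitFactorial e = -1ℤ ^ (p *ℕ α *ℕ e) * + unitFactorial e

  unitFactorial-suc : ∀ e → unitFactorial (suc e) ≡ blockFactorial p (α *ℕ p ^ℕ e) *ℕ unitFactorial e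
  unitFactorial-suc e =
    trans (cong (λ m → unitPart p (m !)) (regroup α p (p ^ℕ e))) (unitPart-[m*p]! p-prime (α *ℕ p ^ℕ e))
    where
    regroup : ∀ α p P → α *ℕ (p *ℕ P) ≡ α *ℕ P *ℕ p
    regroup = ℕ-solve-∀

  signs-cancel : ∀ e →
    -1ℤ ^ (p *ℕ α *ℕ suc (suc e)) * -1ℤ ^ (α *ℕ p ^ℕ suc e) ≡ -1ℤ ^ (p *ℕ α *ℕ suc e)
  signs-cancel e = begin
    -1ℤ ^ (p *ℕ α *ℕ suc (suc e)) * -1ℤ ^ (α *ℕ p ^ℕ suc e)
      ≡⟨ cong₂ (λ m n → -1ℤ ^ m * -1ℤ ^ n) (ℕ.*-suc (p *ℕ α) (suc e)) (ℕ.*-comm α (p ^ℕ suc e)) ⟩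
    -1ℤ ^ (pα +ℕ pα *ℕ suc e) * -1ℤ ^ (p ^ℕ suc e *ℕ α)
      ≡⟨ cong₂ _*_ (ℤ.^-distribˡ-+-* -1ℤ pα (pα *ℕ suc e)) (-1^[n^[1+e]*m]≡-1^[n*m] p e α) ⟩
    ε * S * ε               ≡⟨ rearrange ε S ⟩
    S * (ε * ε)             ≡⟨ cong (S *_) (ℤ.^-distribˡ-+-* -1ℤ pα pα) ⟨
    S * -1ℤ ^ (pα +ℕ pα)    ≡⟨ cong (S *_) (-1^[n+n]≡1 pα) ⟩
    S * 1ℤ                  ≡⟨ ℤ.*-identityʳ S ⟩
    S                       ∎
    where
    open ≡-Reasoning
    pα : ℕ
    pα = p *ℕ α
    ε S : ℤ
    ε = -1ℤ ^ pα
    S = -1ℤ ^ (pα *ℕ suc e)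
    rearrange : ∀ ε S → ε * S * ε ≡ S * (ε * ε)
    rearrange = solve-∀

  signedUnitFactorial-step : ∀ k e → k +ℕ k ≤ e →
    signedUnitFactorial (suc e) ≡ signedUnitFactorial e mod p ^ℕ k
  signedUnitFactorial-step zero    e       _ = ≡mod (∣ᵤ⇒∣ (ℕ.1∣ _))
  signedUnitFactorial-step (suc k) (suc e) (s≤s k+1+k≤e) = begin
    S * + unitFactorial (suc (suc e))  ≡⟨ cong (λ u → S * + u) (unitFactorial-suc (suc e)) ⟩
    S * + (G *ℕ U)                     ≡⟨ cong (S *_) (ℤ.pos-* G U) ⟩
    S * (+ G * + U)                    ≈⟨ *-cong-mod (≡mod-refl {x = S}) (*-cong-mod G≡±1 (≡mod-refl {x = + U})) ⟩
    S * (ε * + U)                      ≡⟨ ℤ.*-assoc S ε (+ U) ⟨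
    S * ε * + U                        ≡⟨ cong (_* + U) (signs-cancel e) ⟩
    signedUnitFactorial (suc e)        ∎
    where
    open ≡mod-Reasoning (p ^ℕ suc k)
    S ε : ℤ
    S = -1ℤ ^ (p *ℕ α *ℕ suc (suc e))
    ε = -1ℤ ^ (α *ℕ p ^ℕ suc e)
    G U : ℕ
    G = blockFactorial p (α *ℕ p ^ℕ suc e)
    U = unitFactorial (suc e)
    G≡±1 : + G ≡ ε mod p ^ℕ suc k
    G≡±1 = blockFactorial-α*p^e≡±1 k (suc e)
      (ℕ.≤-trans (ℕ.+-monoʳ-≤ k (ℕ.n≤1+n k)) (ℕ.m≤n⇒m≤1+n k+1+k≤e))

  signedUnitFactorial-hasLimit : HasLimit p signedUnitFactorial
  signedUnitFactorial-hasLimit = cauchy⇒hasLimit signedUnitFactorial (λ k → k +ℕ k)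
    (λ k → ℕ.+-mono-≤ (ℕ.n≤1+n k) (ℕ.n≤1+n k)) signedUnitFactorial-step

corollary1p2 : (p α : ℕ) → Prime p → 0 < α → ¬ (p ℕ.∣ α) →
    HasLimit p (λ e → ((- (+ 1)) ^ (p *ℕ α *ℕ e)) * (+ unitPart p ((α *ℕ p ^ℕ e) !)))
corollary1p2 p α p-prime _ _ = signedUnitFactorial-hasLimit p-prime α
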